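{- The game $i\textsc{ -Mark}(\{1,3\},\{2,3\})$ has no convergence: there is no integer $c$ such that convergence occurs in at most $c$ steps for every starting position.
   Context: For sets $S,D$ of positive integers with $\min D\ge 2$, the impartial game $i\textsc{ -Mark}(S,D)$ has positions $n\in\mathbb N=\{0,1,2,\dots\}$; from $n$ one may move to $n-s$ for any $s\in S$ with $n-s\ge 0$ (a subtraction follower), and to $n/d$ for any $d\in D$ with $n>0$ and $d\mid n$ (a division follower). $\mathcal G$ denotes the Sprague--Grundy function: $\mathcal G(n)=\operatorname{mex}\{\mathcal G(w): w \text{ a follower of } n\}$, where $\operatorname{mex} A=\min(\mathbb N\setminus A)$. Let $\varphi(n)$ be the number of followers of $n$ and $s=\max S$. A guess seed for starting position $n$ is a tuple $\overline\sigma=(\sigma_n,\dots,\sigma_{n+s-1})$ of integers with $0\le\sigma_i\le\varphi(i)$; $\Sigma_n$ is the set of all such seeds. The guess sequence $\mathcal G_{\overline\sigma}$ is defined by $\mathcal G_{\overline\sigma}(i)=\sigma_i$ for $n\le i<n+s$ and, for $m\ge n+s$, $\mathcal G_{\overline\sigma}(m)=\operatorname{mex}\big(\{\mathcal G_{\overline\sigma}(m-t): t\in S\}\cup\{\mathcal G(m/d): d\in D,\ d\mid m\}\big)$. Convergence occurs in $c$ steps starting at position $n$ if $c\ge s$ and $\mathcal G_{\overline\sigma}(m)=\mathcal G_{\overline\sigma'}(m)$ for all $\overline\sigma,\overline\sigma'\in\Sigma_n$ and all $n+c\le m<n+c+s$. For a game, convergence occurs in $c$ steps if for every starting position $n$ convergence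 occurs in at most $c$ steps. -}

module Defs where

open import Data.Nat using (ℕ; zero; suc; _+_; _∸_; _≤_; _<_; _≤?_; _<?_; _⊔_)
open import Data.Nat.Properties using (_≟_)
open import Data.Nat.Divisibility using (_∣_; _∣?_; quotient)
open import Data.List using (List; []; _∷_; _++_; map; length; foldr; deduplicate)
open import Data.List.Membership.DecPropositional _≟_ using (_∈?_)
open import Data.Product using (Σ; _×_; ∃)
open import Relation.Nullary using (yes; no; ¬_)
open import Relation.Binary.PropositionalEquality using (_≡_)

-- mex of a finite list: least natural number not occurring in it.
-- (The mex is always ≤ length xs, so searching that far suffices.)
mexAux : ℕ → ℕ → List ℕ → ℕ
mexAux zero    m xs = m
mexAux (suc f) m xs with m ∈? xs
... | yes _ = mexAux f (suc m) xs
... | no  _ = m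

mex : List ℕ → ℕ
mex xs = mexAux (length xs) 0 xs

module IMark (S D : List ℕ) where

  s : ℕ
  s = foldr _⊔_ 0 S

  subFollowers : ℕ → List ℕ → List ℕ
  subFollowers n []      = []
  subFollowers n (t ∷ ts) with t ≤? n
  ... | yes _ = (n ∸ t) ∷ subFollowers n ts
  ... | no  _ = subFollowers n ts

  divValues : ℕ → List ℕ → List ℕ
  divValues n []       = []
  divValues n (d ∷ ds) with d ∣? n
  ... | yes p = quotient p ∷ divValues n ds
  ... | no  _ = divValues n ds

  divFollowers : ℕ → List ℕ
  divFollowers zero    = []
  divFollowers (suc k) = divValues (suc k) D

  followers : ℕ → List ℕ
  followers n = subFollowers n S ++ divFollowers n

  φ : ℕ → ℕ
  φ n = length (deduplicate _≟_ (followers n))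

  -- Sprague–Grundy function, by recursion on a fuel parameter;
  -- followers of n are < n, so fuel (suc n) suffices.
  Gf : ℕ → ℕ → ℕ
  Gf zero    n = 0
  Gf (suc f) n = mex (map (Gf f) (followers n))

  G : ℕ → ℕ
  G n = Gf (suc n) n

  -- Guess sequence for starting position n and seed σ, in offset form:
  -- guessF fuel n σ k = 𝒢_σ(n + k).  σ k is the seed entry σ_{n+k} for k < s.
  guessF : ℕ → ℕ → (ℕ → ℕ) → ℕ → ℕ
  guessF zero    n σ k = 0
  guessF (suc f) n σ k with k <? s
  ... | yes _ = σ k
  ... | no  _ = mex (map (λ t → guessF f n σ (k ∸ t)) S
                     ++ map G (divFollowers (n + k)))

  guess : ℕ → (ℕ → ℕ) → ℕ → ℕ
  guess n σ k = guessF (suc k) n σ k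

  IsSeed : ℕ → (ℕ → ℕ) → Set
  IsSeed n σ = ∀ i → i < s → σ i ≤ φ (n + i)

  ConvergesIn : ℕ → ℕ → Set
  ConvergesIn c n =
    s ≤ c ×
    (∀ σ σ' → IsSeed n σ → IsSeed n σ' →
      ∀ j → j < s → guess n σ (c + j) ≡ guess n σ' (c + j))

  GameConvergesIn : ℕ → Set
  GameConvergesIn c = ∀ n → Σ ℕ λ c' → c' ≤ c × ConvergesIn c' n

{-# OPTIONS --safe #-}
-- From position 15 we follow two guess sequences (seeds 0,1,0 and 1,0,1). The first keeps the
-- shape of G itself (which has it from 6 on): nonzero at even positions, 0 at positions coprime
-- to 6. The second keeps a swapped shape: nonzero at odd positions, 1 at positions coprime to 6,
-- never 1 at even positions, 0 at multiples of 4. Both shapes pass through the mex rule because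
-- the subtraction followers m ∸ 1 and m ∸ 3 have equal parity: for even m one of them is coprime
-- to 6, for odd m one of them is a multiple of 4; positions coprime to 6 have no division
-- followers, and the division followers of a multiple of 4 are even and, as m ≥ 18, at least 6,
-- so G is nonzero there.
-- Any three consecutive positions contain one coprime to 6 or divisible by 4, where the shapes
-- force different values, so the two sequences never agree on a window of length s = 3.
module Submission where

open import Defs
open import Data.Nat
open import Data.Nat.Properties
open import Data.Nat.Divisibility
open import Data.Nat.Coprimality using (Coprime; coprime-divisor; coprime-+; 1-coprimeTo)
  renaming (sym to coprime-sym)
open import Data.List using (List; []; _∷_; _++_; map; length; foldr)
open import Data.List.Properties using (map-cong-local)
open import Data.List.Membership.Propositional using (_∈_; _∉_)
open import Data.List.Membership.DecPropositional _≟_ using (_∈?_)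
open import Data.List.Relation.Unary.Any using (here; there)
open import Data.List.Relation.Unary.All as All using (All; []; _∷_)
open import Data.List.Relation.Unary.All.Properties using (All¬⇒¬Any; ++⁺; map⁺)
open import Data.Product as Product using (∃; ∃-syntax; _×_; _,_; proj₂)
open import Data.Sum as Sum using (_⊎_; inj₁; inj₂)
open import Function using (_∘_)
open import Relation.Binary.Definitions using (tri<; tri≈; tri>)
open import Relation.Nullary using (¬_; yes; no; contradiction)
open import Relation.Binary.PropositionalEquality

mexAux-minimal : ∀ f m xs {y} → m ≤ y → y < mexAux f m xs → y ∈ xs
mexAux-minimal zero    m xs m≤y y<m = contradiction y<m (≤⇒≯ m≤y)
mexAux-minimal (suc f) m xs m≤y y<r with m ∈? xs
... | no _ = contradiction y<r (≤⇒≯ m≤y)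
... | yes m∈xs with m≤n⇒m<n∨m≡n m≤y
...   | inj₁ m<y  = mexAux-minimal f (suc m) xs m<y y<r
...   | inj₂ refl = m∈xs

mexAux-∉ : ∀ f m xs → mexAux f m xs < m + f → mexAux f m xs ∉ xs
mexAux-∉ zero    m xs m<m+0 = contradiction (subst (m <_) (+-identityʳ m) m<m+0) (n≮n m)
mexAux-∉ (suc f) m xs r<m+1+f with m ∈? xs
... | yes _   = mexAux-∉ f (suc m) xs (subst (mexAux f (suc m) xs <_) (+-suc m f) r<m+1+f)
... | no m∉xs = m∉xs

mex-minimal : ∀ xs {y} → y < mex xs → y ∈ xs
mex-minimal xs = mexAux-minimal (length xs) 0 xs z≤n

-- mex only searches the first length xs candidates, hence the bound.
mex-∉ : ∀ xs → mex xs < length xs → mex xs ∉ xs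
mex-∉ xs = mexAux-∉ (length xs) 0 xs

mex-≢ : ∀ {xs v} → v ∈ xs → v < length xs → mex xs ≢ v
mex-≢ {xs} v∈xs v<len refl = mex-∉ xs v<len v∈xs

mex-≡ : ∀ {xs v} → v ∉ xs → (∀ {y} → y < v → y ∈ xs) → v ≤ length xs → mex xs ≡ v
mex-≡ {xs} {v} v∉xs below v≤len with <-cmp (mex xs) v
... | tri< lt _ _ = contradiction (below lt) (mex-∉ xs (<-≤-trans lt v≤len))
... | tri≈ _ eq _ = eq
... | tri> _ _ gt = contradiction (mex-minimal xs gt) v∉xs

All≢⇒∉ : ∀ {A : Set} {v : A} {xs} → All (_≢ v) xs → v ∉ xs
All≢⇒∉ = All¬⇒¬Any ∘ All.map ≢-sym

∈-first-two : ∀ {A : Set} {v a b : A} {xs} → a ≡ v ⊎ b ≡ v → v ∈ a ∷ b ∷ xs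
∈-first-two (inj₁ refl) = here refl
∈-first-two (inj₂ refl) = there (here refl)

module _ (S D : List ℕ) where
  open IMark S D

  ∈-divValues⁻ : ∀ {m x} ds → x ∈ divValues m ds → ∃[ d ] d ∈ ds × m ≡ x * d
  ∈-divValues⁻ {m} (d ∷ ds) x∈ with d ∣? m | x∈
  ... | yes (divides q eq) | here refl = d , here refl , eq
  ... | yes _              | there x∈′ = Product.map₂ (Product.map₁ there) (∈-divValues⁻ ds x∈′)
  ... | no _               | x∈′       = Product.map₂ (Product.map₁ there) (∈-divValues⁻ ds x∈′)

  divValues-≡[] : ∀ {m} ds → All (_∤ m) ds → divValues m ds ≡ []
  divValues-≡[]     []       []          = refl
  divValues-≡[] {m} (d ∷ ds) (d∤m ∷ d∤ms) with d ∣? m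
  ... | yes d∣m = contradiction d∣m d∤m
  ... | no  _   = divValues-≡[] ds d∤ms

max≤⇒All∸< : ∀ {k} ts → All (1 ≤_) ts → foldr _⊔_ 0 ts ≤ k → All (λ t → k ∸ t < k) ts
max≤⇒All∸< []       []            _ = []
max≤⇒All∸< (t ∷ ts) (1≤t ∷ 1≤ts) max≤k =
  ∸-monoʳ-< 1≤t (m⊔n≤o⇒m≤o t _ max≤k) ∷ max≤⇒All∸< ts 1≤ts (m⊔n≤o⇒n≤o t _ max≤k)

-- Gf and guessF compute by recursion on a fuel parameter; once the fuel exceeds the
-- position, more fuel does not change the value, since every follower is smaller.
module _ (S D : List ℕ) (S-positive : All (1 ≤_) S) (D-nontrivial : All (2 ≤_) D) where
  open IMark S D

  subFollowers-< : ∀ n ts → All (1 ≤_) ts → All (_< n) (subFollowers n ts)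
  subFollowers-< n []       []            = []
  subFollowers-< n (t ∷ ts) (1≤t ∷ 1≤ts) with t ≤? n
  ... | yes t≤n = ∸-monoʳ-< 1≤t t≤n ∷ subFollowers-< n ts 1≤ts
  ... | no  _   = subFollowers-< n ts 1≤ts

  divValues-< : ∀ m ds → All (2 ≤_) ds → All (_< suc m) (divValues (suc m) ds)
  divValues-< m []       []            = []
  divValues-< m (d ∷ ds) (2≤d ∷ 2≤ds) with d ∣? suc m
  ... | yes d∣m = quotient-< d∣m {{n>1⇒nonTrivial 2≤d}} ∷ divValues-< m ds 2≤ds
  ... | no  _   = divValues-< m ds 2≤ds

  followers-< : ∀ n → All (_< n) (followers n)
  followers-< zero    = ++⁺ (subFollowers-< zero S S-positive) []
  followers-< (suc m) = ++⁺ (subFollowers-< (suc m) S S-positive) (divValues-< m D D-nontrivial)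

  Gf-stable : ∀ {f f′ n} → n < f → n < f′ → Gf f n ≡ Gf f′ n
  Gf-stable {suc f} {suc f′} {n} (s≤s n≤f) (s≤s n≤f′) = cong mex (map-cong-local
    (All.map (λ x<n → Gf-stable (<-≤-trans x<n n≤f) (<-≤-trans x<n n≤f′)) (followers-< n)))

  G-unfold : ∀ n → G n ≡ mex (map G (followers n))
  G-unfold n = cong mex (map-cong-local
    (All.map (λ {x} x<n → Gf-stable x<n (n<1+n x)) (followers-< n)))

  guessF-stable : ∀ {n σ f f′ k} → k < f → k < f′ → guessF f n σ k ≡ guessF f′ n σ k
  guessF-stable {n} {σ} {suc f} {suc f′} {k} (s≤s k≤f) (s≤s k≤f′) with k <? s
  ... | yes _   = refl
  ... | no  k≮s = cong (λ xs → mex (xs ++ map G (divFollowers (n + k)))) (map-cong-local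
    (All.map (λ k∸t<k → guessF-stable (<-≤-trans k∸t<k k≤f) (<-≤-trans k∸t<k k≤f′))
             (max≤⇒All∸< S S-positive (≮⇒≥ k≮s))))

  guess-unfold : ∀ {n σ k} → s ≤ k →
    guess n σ k ≡ mex (map (λ t → guess n σ (k ∸ t)) S ++ map G (divFollowers (n + k)))
  guess-unfold {n} {σ} {k} s≤k with k <? s
  ... | yes k<s = contradiction s≤k (<⇒≱ k<s)
  ... | no  _   = cong (λ xs → mex (xs ++ map G (divFollowers (n + k)))) (map-cong-local
    (All.map (λ {t} k∸t<k → guessF-stable k∸t<k (n<1+n (k ∸ t))) (max≤⇒All∸< S S-positive s≤k)))

∣⇒∤+ : ∀ {d k q} → 0 < k → k < d → d ∣ q → d ∤ k + q
∣⇒∤+ {d} {k} {q} 0<k k<d d∣q d∣k+q =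
  >⇒∤ {{>-nonZero 0<k}} k<d (∣m+n∣m⇒∣n (subst (d ∣_) (+-comm k q) d∣k+q) d∣q)

2∣2+⇒2∣ : ∀ {q} → 2 ∣ 2 + q → 2 ∣ q
2∣2+⇒2∣ 2∣2+q = ∣m+n∣m⇒∣n 2∣2+q ∣-refl

2∣⇒2∣2+ : ∀ {q} → 2 ∣ q → 2 ∣ 2 + q
2∣⇒2∣2+ = ∣m∣n⇒∣m+n ∣-refl

2∣⇒2∤1+ : ∀ {q} → 2 ∣ q → 2 ∤ 1 + q
2∣⇒2∤1+ = ∣⇒∤+ (s≤s z≤n) ≤-refl

2∣⊎2∣1+ : ∀ q → 2 ∣ q ⊎ 2 ∣ 1 + q
2∣⊎2∣1+ zero    = inj₁ (divides 0 refl)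
2∣⊎2∣1+ (suc q) = Sum.swap (Sum.map₁ 2∣⇒2∣2+ (2∣⊎2∣1+ q))

2∤1+⇒2∣ : ∀ {q} → 2 ∤ 1 + q → 2 ∣ q
2∤1+⇒2∣ {q} 2∤1+q with 2∣⊎2∣1+ q
... | inj₁ 2∣q   = 2∣q
... | inj₂ 2∣1+q = contradiction 2∣1+q 2∤1+q

3∤2+⊎3∤ : ∀ q → 3 ∤ 2 + q ⊎ 3 ∤ q
3∤2+⊎3∤ q with 3 ∣? q
... | yes 3∣q = inj₁ (∣⇒∤+ (s≤s z≤n) ≤-refl 3∣q)
... | no  3∤q = inj₂ 3∤q

2∣⇒4∣2+⊎4∣ : ∀ {q} → 2 ∣ q → 4 ∣ 2 + q ⊎ 4 ∣ q
2∣⇒4∣2+⊎4∣ (divides k refl) with 2∣⊎2∣1+ k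
... | inj₁ 2∣k   = inj₂ (*-monoˡ-∣ 2 2∣k)
... | inj₂ 2∣1+k = inj₁ (*-monoˡ-∣ 2 2∣1+k)

4∣⇒2∣ : ∀ {m} → 4 ∣ m → 2 ∣ m
4∣⇒2∣ = ∣-trans (divides 2 refl)

CoprimeTo6 : ℕ → Set
CoprimeTo6 m = 2 ∤ m × 3 ∤ m

odd-neighbours : ∀ {q} → 2 ∣ 3 + q → 2 ∤ 2 + q × 2 ∤ q
odd-neighbours 2∣3+q = (λ 2∣2+q → 2∣⇒2∤1+ 2∣2+q 2∣3+q)
                     , (λ 2∣q → 2∣⇒2∤1+ (2∣⇒2∣2+ 2∣q) 2∣3+q)

even-neighbours : ∀ {q} → 2 ∤ 3 + q → 2 ∣ 2 + q × 2 ∣ q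
even-neighbours 2∤3+q = 2∣2+q , 2∣2+⇒2∣ 2∣2+q
  where 2∣2+q = 2∤1+⇒2∣ 2∤3+q

coprime-neighbour : ∀ {q} → 2 ∣ 3 + q → CoprimeTo6 (2 + q) ⊎ CoprimeTo6 q
coprime-neighbour {q} 2∣3+q with odd-neighbours 2∣3+q
... | 2∤2+q , 2∤q = Sum.map (2∤2+q ,_) (2∤q ,_) (3∤2+⊎3∤ q)

quadruple-neighbour : ∀ {q} → 2 ∤ 3 + q → 4 ∣ 2 + q ⊎ 4 ∣ q
quadruple-neighbour = 2∣⇒4∣2+⊎4∣ ∘ proj₂ ∘ even-neighbours

Distinguishing : ℕ → Set
Distinguishing m = CoprimeTo6 m ⊎ 4 ∣ m

distinguishing-window : ∀ m → ∃[ j ] j < 3 × Distinguishing (j + m)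
distinguishing-window m with 2 ∣? m
... | yes 2∣m with 2∣⇒4∣2+⊎4∣ 2∣m
...   | inj₁ 4∣2+m = 2 , ≤-refl , inj₂ 4∣2+m
...   | inj₂ 4∣m   = 0 , s≤s z≤n , inj₂ 4∣m
distinguishing-window m | no 2∤m with 3 ∣? m
... | yes 3∣m = 2 , ≤-refl , inj₁ (2∤m ∘ 2∣2+⇒2∣ , ∣⇒∤+ (s≤s z≤n) ≤-refl 3∣m)
... | no  3∤m = 0 , s≤s z≤n , inj₁ (2∤m , 3∤m)

open IMark (1 ∷ 3 ∷ []) (2 ∷ 3 ∷ [])

S-positive : All (1 ≤_) (1 ∷ 3 ∷ [])
S-positive = s≤s z≤n ∷ s≤s z≤n ∷ []

D-nontrivial : All (2 ≤_) (2 ∷ 3 ∷ [])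
D-nontrivial = s≤s (s≤s z≤n) ∷ s≤s (s≤s z≤n) ∷ []

-- The mex rule at position m, given the values a at m ∸ 1 and b at m ∸ 3.
mexStep : ℕ → ℕ → ℕ → ℕ
mexStep m a b = mex (a ∷ b ∷ map G (divFollowers m))

G-recurrence : ∀ q → G (3 + q) ≡ mexStep (3 + q) (G (2 + q)) (G q)
G-recurrence q = G-unfold _ _ S-positive D-nontrivial (3 + q)

guess-recurrence : ∀ {n σ} j →
  guess n σ (3 + j) ≡ mexStep (3 + j + n) (guess n σ (2 + j)) (guess n σ j)
guess-recurrence {n} {σ} j = trans
  (guess-unfold _ _ S-positive D-nontrivial (m≤m+n 3 j))
  (cong (λ m → mexStep m (guess n σ (2 + j)) (guess n σ j)) (+-comm n (3 + j)))

mexStep-coprime : ∀ {m} a b → CoprimeTo6 (suc m) → mexStep (suc m) a b ≡ mex (a ∷ b ∷ [])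
mexStep-coprime a b (2∤m , 3∤m) = cong (λ ys → mex (a ∷ b ∷ map G ys))
  (divValues-≡[] (1 ∷ 3 ∷ []) (2 ∷ 3 ∷ []) (2 ∷ 3 ∷ []) (2∤m ∷ 3∤m ∷ []))

mexStep-≢ : ∀ m {a b v} → a ≡ v ⊎ b ≡ v → v < 2 → mexStep m a b ≢ v
mexStep-≢ m {a} {b} a∨b≡v v<2 =
  mex-≢ {xs = a ∷ b ∷ map G (divFollowers m)} (∈-first-two a∨b≡v) (≤-trans v<2 (s≤s (s≤s z≤n)))

MexInvariant : (ℕ → ℕ → Set) → ℕ → Set
MexInvariant I q₀ =
  ∀ {q a b} → q₀ ≤ q → I (2 + q) a → I q b → I (3 + q) (mexStep (3 + q) a b)

propagate : ∀ {I n} → MexInvariant I n → (h : ℕ → ℕ) →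
  (∀ j → h (3 + j) ≡ mexStep (3 + j + n) (h (2 + j)) (h j)) →
  I n (h 0) → I (1 + n) (h 1) → I (2 + n) (h 2) → ∀ k → I (k + n) (h k)
propagate {I} {n} inv h rec I₀ I₁ I₂ = go
  where
  go : ∀ k → I (k + n) (h k)
  go 0 = I₀
  go 1 = I₁
  go 2 = I₂
  go (suc (suc (suc j))) =
    subst (I (3 + j + n)) (sym (rec j))
          (inv {a = h (2 + j)} {h j} (m≤n+m n j) (go (suc (suc j))) (go j))

record GrundyPattern (m v : ℕ) : Set where
  field
    even⇒≢0    : 2 ∣ m → v ≢ 0
    coprime⇒≡0 : CoprimeTo6 m → v ≡ 0

record SwappedPattern (m v : ℕ) : Set where
  field
    odd⇒≢0     : 2 ∤ m → v ≢ 0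
    coprime⇒≡1 : CoprimeTo6 m → v ≡ 1
    even⇒≢1    : 2 ∣ m → v ≢ 1
    4∣⇒≡0      : 4 ∣ m → v ≡ 0

grundy-step : ∀ {q₀} → MexInvariant GrundyPattern q₀
grundy-step {q = q} {a} {b} _ Pa Pb = record
  { even⇒≢0    = λ 2∣m → mexStep-≢ (3 + q)
      (Sum.map (coprime⇒≡0 Pa) (coprime⇒≡0 Pb) (coprime-neighbour 2∣m)) (s≤s z≤n)
  ; coprime⇒≡0 = λ coprime@(2∤m , _) → let 2∣2+q , 2∣q = even-neighbours 2∤m in
      trans (mexStep-coprime a b coprime)
            (mex-≡ {a ∷ b ∷ []} (All≢⇒∉ (even⇒≢0 Pa 2∣2+q ∷ even⇒≢0 Pb 2∣q ∷ [])) (λ ()) z≤n)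
  }
  where open GrundyPattern

G-grundy : ∀ {x} → 6 ≤ x → GrundyPattern x (G x)
G-grundy {x} 6≤x = subst (λ y → GrundyPattern y (G y)) (m∸n+n≡m 6≤x)
  (propagate {GrundyPattern} {6} grundy-step (λ k → G (k + 6)) (λ j → G-recurrence (j + 6))
             G₆ G₇ G₈ (x ∸ 6))
  where
  G₆ : GrundyPattern 6 (G 6)
  G₆ = record { even⇒≢0    = λ _ ()
              ; coprime⇒≡0 = λ (2∤6 , _) → contradiction (divides 3 refl) 2∤6 }
  G₇ : GrundyPattern 7 (G 7)
  G₇ = record { even⇒≢0    = λ 2∣7 → contradiction 2∣7 (2∣⇒2∤1+ (divides 3 refl))
              ; coprime⇒≡0 = λ _ → refl }
  G₈ : GrundyPattern 8 (G 8)
  G₈ = record { even⇒≢0    = λ _ ()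
              ; coprime⇒≡0 = λ (2∤8 , _) → contradiction (divides 4 refl) 2∤8 }

cofactor-even : ∀ {x d} → d ∈ 2 ∷ 3 ∷ [] → 4 ∣ x * d → 2 ∣ x
cofactor-even     (here refl)         4∣2x = *-cancelʳ-∣ 2 4∣2x
cofactor-even {x} (there (here refl)) 4∣3x =
  coprime-divisor 2⊥3 (subst (2 ∣_) (*-comm x 3) (4∣⇒2∣ 4∣3x))
  where
  2⊥3 : Coprime 2 3
  2⊥3 = coprime-sym (coprime-+ (1-coprimeTo 2))

cofactor-≥6 : ∀ {x d} → d ∈ 2 ∷ 3 ∷ [] → 18 ≤ x * d → 6 ≤ x
cofactor-≥6 {x} (here refl)         18≤2x =
  *-cancelʳ-≤ 6 x 3 (≤-trans 18≤2x (*-monoʳ-≤ x (n≤1+n 2)))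
cofactor-≥6 {x} (there (here refl)) 18≤3x = *-cancelʳ-≤ 6 x 3 18≤3x

G-quotients-≢0 : ∀ {m} → 18 ≤ m → 4 ∣ m → All (_≢ 0) (map G (divValues m (2 ∷ 3 ∷ [])))
G-quotients-≢0 {m} 18≤m 4∣m = map⁺ (All.tabulate λ {x} x∈ →
  let d , d∈ , m≡x*d = ∈-divValues⁻ (1 ∷ 3 ∷ []) (2 ∷ 3 ∷ []) (2 ∷ 3 ∷ []) x∈ in
  GrundyPattern.even⇒≢0 (G-grundy {x} (cofactor-≥6 d∈ (subst (18 ≤_) m≡x*d 18≤m)))
                        (cofactor-even {x} d∈ (subst (4 ∣_) m≡x*d 4∣m)))

swapped-step : MexInvariant SwappedPattern 15
swapped-step {q} {a} {b} 15≤q Pa Pb = record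
  { odd⇒≢0     = λ 2∤m → mexStep-≢ (3 + q) (zero-before 2∤m) (s≤s z≤n)
  ; coprime⇒≡1 = λ coprime@(2∤m , _) → let 2∣2+q , 2∣q = even-neighbours 2∤m in
      trans (mexStep-coprime a b coprime)
            (mex-≡ {a ∷ b ∷ []} (All≢⇒∉ (even⇒≢1 Pa 2∣2+q ∷ even⇒≢1 Pb 2∣q ∷ []))
                   (λ { (s≤s z≤n) → ∈-first-two (zero-before 2∤m) }) (s≤s z≤n))
  ; even⇒≢1    = λ 2∣m → mexStep-≢ (3 + q)
      (Sum.map (coprime⇒≡1 Pa) (coprime⇒≡1 Pb) (coprime-neighbour 2∣m)) ≤-refl
  ; 4∣⇒≡0      = λ 4∣m → let 2∤2+q , 2∤q = odd-neighbours (4∣⇒2∣ 4∣m) in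
      mex-≡ {a ∷ b ∷ map G (divFollowers (3 + q))}
            (All≢⇒∉ (odd⇒≢0 Pa 2∤2+q ∷ odd⇒≢0 Pb 2∤q ∷ G-quotients-≢0 (+-monoʳ-≤ 3 15≤q) 4∣m))
            (λ ()) z≤n
  }
  where
  open SwappedPattern
  zero-before : 2 ∤ 3 + q → a ≡ 0 ⊎ b ≡ 0
  zero-before 2∤m = Sum.map (4∣⇒≡0 Pa) (4∣⇒≡0 Pb) (quadruple-neighbour 2∤m)

grundySeed : ℕ → ℕ
grundySeed 1 = 1
grundySeed _ = 0

swappedSeed : ℕ → ℕ
swappedSeed 1 = 0
swappedSeed _ = 1

grundySeed-isSeed : IsSeed 15 grundySeed
grundySeed-isSeed 0 _ = z≤n
grundySeed-isSeed 1 _ = s≤s z≤n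
grundySeed-isSeed 2 _ = z≤n
grundySeed-isSeed (suc (suc (suc _))) (s≤s (s≤s (s≤s ())))

swappedSeed-isSeed : IsSeed 15 swappedSeed
swappedSeed-isSeed 0 _ = s≤s z≤n
swappedSeed-isSeed 1 _ = z≤n
swappedSeed-isSeed 2 _ = s≤s z≤n
swappedSeed-isSeed (suc (suc (suc _))) (s≤s (s≤s (s≤s ())))

2∤15 : 2 ∤ 15
2∤15 = 2∣⇒2∤1+ (divides 7 refl)

2∤17 : 2 ∤ 17
2∤17 = 2∣⇒2∤1+ (divides 8 refl)

guess-grundy : ∀ k → GrundyPattern (k + 15) (guess 15 grundySeed k)
guess-grundy = propagate {GrundyPattern} {15} grundy-step
  (guess 15 grundySeed) (guess-recurrence {15} {grundySeed})
  (record { even⇒≢0    = λ 2∣15 → contradiction 2∣15 2∤15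
          ; coprime⇒≡0 = λ _ → refl })
  (record { even⇒≢0    = λ _ ()
          ; coprime⇒≡0 = λ (2∤16 , _) → contradiction (divides 8 refl) 2∤16 })
  (record { even⇒≢0    = λ 2∣17 → contradiction 2∣17 2∤17
          ; coprime⇒≡0 = λ _ → refl })

guess-swapped : ∀ k → SwappedPattern (k + 15) (guess 15 swappedSeed k)
guess-swapped = propagate {SwappedPattern} {15} swapped-step
  (guess 15 swappedSeed) (guess-recurrence {15} {swappedSeed})
  (record { odd⇒≢0     = λ _ ()
          ; coprime⇒≡1 = λ _ → refl
          ; even⇒≢1    = λ 2∣15 → contradiction 2∣15 2∤15
          ; 4∣⇒≡0      = λ 4∣15 → contradiction (4∣⇒2∣ 4∣15) 2∤15 })
  (record { odd⇒≢0     = λ 2∤16 → contradiction (divides 8 refl) 2∤16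
          ; coprime⇒≡1 = λ (2∤16 , _) → contradiction (divides 8 refl) 2∤16
          ; even⇒≢1    = λ _ ()
          ; 4∣⇒≡0      = λ _ → refl })
  (record { odd⇒≢0     = λ _ ()
          ; coprime⇒≡1 = λ _ → refl
          ; even⇒≢1    = λ 2∣17 → contradiction 2∣17 2∤17
          ; 4∣⇒≡0      = λ 4∣17 → contradiction (4∣⇒2∣ 4∣17) 2∤17 })

patterns-disagree : ∀ {m a b} →
  GrundyPattern m a → SwappedPattern m b → Distinguishing m → a ≢ b
patterns-disagree Pa Pb (inj₁ coprime) a≡b =
  0≢1+n (trans (sym (coprime⇒≡0 Pa coprime)) (trans a≡b (coprime⇒≡1 Pb coprime)))
  where open GrundyPattern; open SwappedPattern
patterns-disagree Pa Pb (inj₂ 4∣m) a≡b = even⇒≢0 Pa (4∣⇒2∣ 4∣m) (trans a≡b (4∣⇒≡0 Pb 4∣m))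
  where open GrundyPattern; open SwappedPattern

no-convergence-from-15 : ∀ c → ¬ ConvergesIn c 15
no-convergence-from-15 c (_ , agree) =
  let j , j<3 , distinguishing = distinguishing-window (c + 15)
      reassoc = trans (sym (+-assoc j c 15)) (cong (_+ 15) (+-comm j c))
  in patterns-disagree (guess-grundy (c + j)) (guess-swapped (c + j))
       (subst Distinguishing reassoc distinguishing)
       (agree grundySeed swappedSeed grundySeed-isSeed swappedSeed-isSeed j j<3)

mainTheorem7 : ¬ (∃ λ (c : ℕ) → IMark.GameConvergesIn (1 ∷ 3 ∷ []) (2 ∷ 3 ∷ []) c)
mainTheorem7 (c , converges) = no-convergence-from-15 _ (proj₂ (proj₂ (converges 15)))
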